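{- Let $n\ge 3$ be an even integer and let $\mathcal{F}$ be a 1-factorisation of $Circ(2n,\{1,2\})$. If some configuration $C_e$ is a 3-configuration, then the two configurations adjacent to $C_e$ are 2-configurations, and the 1-edges of these two 2-configurations lie in the same 1-factor of $\mathcal{F}$.
   Context: For a positive integer $N$ and $D\subseteq\{1,\dots,\lfloor N/2\rfloor\}$, the circulant graph $Circ(N,D)$ has vertex set $\mathbb{Z}_N$, with $u,v$ adjacent iff $u-v\equiv \pm d \pmod N$ for some $d\in D$. A 1-factor is a 1-regular spanning subgraph; a 1-factorisation is a partition of the edge set into 1-factors; regard a 1-factorisation as an edge colouring in which each 1-factor is a colour class. In $Circ(2n,\{1,2\})$ (arithmetic mod $2n$), a 1-edge is an edge $\{v,v+1\}$ and a 2-edge is an edge $\{v,v+2\}$. The configuration of the 1-edge $e=\{v,v+1\}$ is $C_e=\{\{v-1,v+1\},\{v,v+1\},\{v,v+2\}\}$; it is a $k$-configuration if exactly $k$ distinct colours (1-factors) occur on its three edges. Configurations $C_e$ and $C_{e'}$ are adjacent if $e\neq e'$ share a vertex. -}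

module Defs where

open import Data.Nat using (ℕ; zero; suc; _+_; _∸_)
open import Data.Nat.DivMod using (_%_; m%n<n)
open import Data.Nat.Properties using () renaming (_≟_ to _≟ℕ_)
open import Data.Fin using (Fin; toℕ; fromℕ<)
open import Data.List using (List; []; _∷_; length; deduplicate)
open import Data.Product using (_×_)
open import Relation.Binary.PropositionalEquality using (_≡_; _≢_)
open import Data.Sum using (_⊎_)

_⊕_ : ∀ {N} → Fin N → ℕ → Fin N
_⊕_ {suc k} v j = fromℕ< (m%n<n (toℕ v + j) (suc k))

-- v ⊖ j  is  v - j  (mod N), for j ≤ N.
_⊖_ : ∀ {N} → Fin N → ℕ → Fin N
_⊖_ {N} v j = v ⊕ (N ∸ j)

-- Edges of Circ(N,{1,2}): the 1-edge {v,v+1} is (v , one),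
-- the 2-edge {v,v+2} is (v , two).  For N ≥ 6 this is a bijection
-- between Fin N × Kind and the edge set.
data Kind : Set where
  one two : Kind

Colouring : ℕ → Set
Colouring N = Fin N → Kind → ℕ

data Pos : Set where
  p1 p2 p3 p4 : Pos

incVertex : ∀ {N} → Fin N → Pos → Fin N
incVertex u p1 = u
incVertex u p2 = u ⊖ 1
incVertex u p3 = u
incVertex u p4 = u ⊖ 2

incKind : Pos → Kind
incKind p1 = one
incKind p2 = one
incKind p3 = two
incKind p4 = two

incColour : ∀ {N} → Colouring N → Fin N → Pos → ℕ
incColour c u p = c (incVertex u p) (incKind p)

-- c is a 1-factorisation: every colour class is a 1-factor, i.e. for every
-- colour k occurring on some edge, every vertex is incident with exactly one
-- edge of colour k.
IsOneFactorisation : ∀ {N} → Colouring N → Set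
IsOneFactorisation {N} c =
  (∀ (u : Fin N) (p q : Pos) → p ≢ q → incColour c u p ≢ incColour c u q)
  × (∀ (v : Fin N) (t : Kind) (u : Fin N) →
       Data.Product.∃ λ (p : Pos) → incColour c u p ≡ c v t)

-- Colours on the configuration C_e of the 1-edge e = {v,v+1}:
--   {v-1,v+1} (2-edge at v-1), {v,v+1} (1-edge at v), {v,v+2} (2-edge at v).
configColours : ∀ {N} → Colouring N → Fin N → List ℕ
configColours c v = c (v ⊖ 1) two ∷ c v one ∷ c v two ∷ []

numColours : ∀ {N} → Colouring N → Fin N → ℕ
numColours c v = length (deduplicate _≟ℕ_ (configColours c v))

IsKConfig : ∀ {N} → ℕ → Colouring N → Fin N → Set
IsKConfig k c v = numColours c v ≡ k

-- Let a, b, d be the colours of {v-1,v+1}, {v,v+1}, {v,v+2}, pairwise distinct.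
-- Vertex v must meet colour a, and the only incident edge that can carry it is
-- {v-2,v}; likewise vertex v+1 meets d only on {v+1,v+3}.  Vertex v must also
-- meet the colour x of {v+1,v+2}, which is now excluded from {v,v+1}, {v,v+2}
-- and {v-2,v}, so {v-1,v} has colour x.  Hence C_{v-1} has colours a,·,a and
-- C_{v+1} has colours d,x,d, both 2-configurations with 1-edges of colour x.
module Submission where

open import Defs
open import Data.Nat using (ℕ; zero; suc; _+_; _∸_; _*_; _≤_; s≤s; z≤n)
open import Data.Nat.Divisibility using (_∣_)
open import Data.Nat.DivMod using (_%_; m%n<n; %-distribˡ-+; m%n%n≡m%n; [m+n]%n≡m%n; m<n⇒m%n≡m)
open import Data.Nat.Properties
  using ( +-assoc; +-comm; +-identityʳ; ≤-trans; m∸n≤m; m+[n∸m]≡n; m∸n+n≡m; ∸-+-assoc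
        ; m+n≤o⇒m≤o∸n)
  renaming (_≟_ to _≟ℕ_)
open import Data.Fin using (Fin; toℕ)
open import Data.Fin.Properties using (toℕ-injective; toℕ-fromℕ<; toℕ<n)
open import Data.List using ([]; _∷_; _++_; length; deduplicate; filter)
open import Data.List.Properties using (filter-accept; filter-reject; filter-++; ++-identityʳ; length-filter)
open import Data.Product using (_×_; _,_; ∃)
open import Data.Empty using (⊥-elim)
open import Relation.Nullary using (Dec; yes; no; ¬_; ¬?)
open import Relation.Binary.PropositionalEquality

module _ {k : ℕ} where
  private
    N : ℕ
    N = suc k

  toℕ-⊕ : (v : Fin N) (j : ℕ) → toℕ (v ⊕ j) ≡ (toℕ v + j) % N
  toℕ-⊕ v j = toℕ-fromℕ< (m%n<n (toℕ v + j) N)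

  ⊕-assoc : (v : Fin N) (i j : ℕ) → (v ⊕ i) ⊕ j ≡ v ⊕ (i + j)
  ⊕-assoc v i j = toℕ-injective (begin
    toℕ ((v ⊕ i) ⊕ j)                  ≡⟨ toℕ-⊕ (v ⊕ i) j ⟩
    (toℕ (v ⊕ i) + j) % N              ≡⟨ cong (λ m → (m + j) % N) (toℕ-⊕ v i) ⟩
    ((toℕ v + i) % N + j) % N          ≡⟨ %-distribˡ-+ ((toℕ v + i) % N) j N ⟩
    ((toℕ v + i) % N % N + j % N) % N  ≡⟨ cong (λ m → (m + j % N) % N) (m%n%n≡m%n (toℕ v + i) N) ⟩
    ((toℕ v + i) % N + j % N) % N      ≡⟨ %-distribˡ-+ (toℕ v + i) j N ⟨
    (toℕ v + i + j) % N                ≡⟨ cong (_% N) (+-assoc (toℕ v) i j) ⟩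
    (toℕ v + (i + j)) % N              ≡⟨ toℕ-⊕ v (i + j) ⟨
    toℕ (v ⊕ (i + j))                  ∎)
    where open ≡-Reasoning

  ⊕-identityʳ : (v : Fin N) → v ⊕ 0 ≡ v
  ⊕-identityʳ v = toℕ-injective (begin
    toℕ (v ⊕ 0)        ≡⟨ toℕ-⊕ v 0 ⟩
    (toℕ v + 0) % N    ≡⟨ cong (_% N) (+-identityʳ (toℕ v)) ⟩
    toℕ v % N          ≡⟨ m<n⇒m%n≡m (toℕ<n v) ⟩
    toℕ v              ∎)
    where open ≡-Reasoning

  ⊕-periodic : (v : Fin N) (j : ℕ) → v ⊕ (j + N) ≡ v ⊕ j
  ⊕-periodic v j = toℕ-injective (begin
    toℕ (v ⊕ (j + N))        ≡⟨ toℕ-⊕ v (j + N) ⟩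
    (toℕ v + (j + N)) % N    ≡⟨ cong (_% N) (+-assoc (toℕ v) j N) ⟨
    (toℕ v + j + N) % N      ≡⟨ [m+n]%n≡m%n (toℕ v + j) N ⟩
    (toℕ v + j) % N          ≡⟨ toℕ-⊕ v j ⟨
    toℕ (v ⊕ j)              ∎)
    where open ≡-Reasoning

  ⊕-⊖-cancel : (v : Fin N) {j : ℕ} → j ≤ N → (v ⊕ j) ⊖ j ≡ v
  ⊕-⊖-cancel v {j} j≤N = begin
    (v ⊕ j) ⊖ j        ≡⟨ ⊕-assoc v j (N ∸ j) ⟩
    v ⊕ (j + (N ∸ j))  ≡⟨ cong (v ⊕_) (m+[n∸m]≡n j≤N) ⟩
    v ⊕ (0 + N)        ≡⟨ ⊕-periodic v 0 ⟩
    v ⊕ 0              ≡⟨ ⊕-identityʳ v ⟩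
    v                  ∎
    where open ≡-Reasoning

  ⊖-⊖ : (v : Fin N) {i j : ℕ} → i + j ≤ N → (v ⊖ i) ⊖ j ≡ v ⊖ (i + j)
  ⊖-⊖ v {i} {j} i+j≤N = begin
    (v ⊖ i) ⊖ j                          ≡⟨ ⊕-assoc v (N ∸ i) (N ∸ j) ⟩
    v ⊕ ((N ∸ i) + (N ∸ j))              ≡⟨ cong (λ m → v ⊕ (m + (N ∸ j))) N∸i≡N∸[i+j]+j ⟩
    v ⊕ ((N ∸ (i + j)) + j + (N ∸ j))    ≡⟨ cong (v ⊕_) (+-assoc (N ∸ (i + j)) j (N ∸ j)) ⟩
    v ⊕ ((N ∸ (i + j)) + (j + (N ∸ j)))  ≡⟨ cong (λ m → v ⊕ ((N ∸ (i + j)) + m)) (m+[n∸m]≡n j≤N) ⟩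
    v ⊕ ((N ∸ (i + j)) + N)              ≡⟨ ⊕-periodic v (N ∸ (i + j)) ⟩
    v ⊖ (i + j)                          ∎
    where
    open ≡-Reasoning
    j≤N∸i : j ≤ N ∸ i
    j≤N∸i = m+n≤o⇒m≤o∸n j (subst (_≤ N) (+-comm i j) i+j≤N)
    j≤N : j ≤ N
    j≤N = ≤-trans j≤N∸i (m∸n≤m N i)
    N∸i≡N∸[i+j]+j : N ∸ i ≡ (N ∸ (i + j)) + j
    N∸i≡N∸[i+j]+j = trans (sym (m∸n+n≡m j≤N∸i)) (cong (_+ j) (∸-+-assoc N i j))

_≢?_ : (y x : ℕ) → Dec (y ≢ x)
y ≢? x = ¬? (y ≟ℕ x)

deduplicate-yzy : (y z : ℕ) →
  deduplicate _≟ℕ_ (y ∷ z ∷ y ∷ []) ≡ y ∷ filter (y ≢?_) (z ∷ [])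
deduplicate-yzy y z with z ≟ℕ y
... | yes refl = cong (λ xs → y ∷ filter (y ≢?_) (y ∷ xs))
                      (filter-reject (y ≢?_) (λ y≢y → y≢y refl))
... | no z≢y = cong (y ∷_) (begin
  filter (y ≢?_) (z ∷ filter (z ≢?_) (y ∷ []))
    ≡⟨ cong (λ xs → filter (y ≢?_) (z ∷ xs)) (filter-accept (z ≢?_) z≢y) ⟩
  filter (y ≢?_) ((z ∷ []) ++ (y ∷ []))
    ≡⟨ filter-++ (y ≢?_) (z ∷ []) (y ∷ []) ⟩
  filter (y ≢?_) (z ∷ []) ++ filter (y ≢?_) (y ∷ [])
    ≡⟨ cong (filter (y ≢?_) (z ∷ []) ++_) (filter-reject (y ≢?_) (λ y≢y → y≢y refl)) ⟩
  filter (y ≢?_) (z ∷ []) ++ []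
    ≡⟨ ++-identityʳ _ ⟩
  filter (y ≢?_) (z ∷ []) ∎)
  where open ≡-Reasoning

length-deduplicate-yzy : {y z : ℕ} → z ≢ y → length (deduplicate _≟ℕ_ (y ∷ z ∷ y ∷ [])) ≡ 2
length-deduplicate-yzy {y} {z} z≢y = begin
  length (deduplicate _≟ℕ_ (y ∷ z ∷ y ∷ []))  ≡⟨ cong length (deduplicate-yzy y z) ⟩
  length (y ∷ filter (y ≢?_) (z ∷ []))        ≡⟨ cong (λ xs → length (y ∷ xs)) (filter-accept (y ≢?_) (≢-sym z≢y)) ⟩
  2                                           ∎
  where open ≡-Reasoning

length-deduplicate-yzy≤2 : (y z : ℕ) → length (deduplicate _≟ℕ_ (y ∷ z ∷ y ∷ [])) ≤ 2
length-deduplicate-yzy≤2 y z = subst (λ xs → length xs ≤ 2) (sym (deduplicate-yzy y z))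
  (s≤s (length-filter (y ≢?_) (z ∷ [])))

Proper : ∀ {N} → Colouring N → Set
Proper {N} c = (u : Fin N) (p q : Pos) → p ≢ q → incColour c u p ≢ incColour c u q

Saturated : ∀ {N} → Colouring N → Set
Saturated {N} c = (v : Fin N) (t : Kind) (u : Fin N) → ∃ λ p → incColour c u p ≡ c v t

proper-at : ∀ {N} (c : Colouring N) → Proper c →
  (u : Fin N) (p q : Pos) → p ≢ q → {w w′ : Fin N} →
  incVertex u p ≡ w → incVertex u q ≡ w′ → c w (incKind p) ≢ c w′ (incKind q)
proper-at c proper u p q p≢q refl refl = proper u p q p≢q

3-config⇒2-edges-distinct : ∀ {N} (c : Colouring N) (v : Fin N) →
  IsKConfig 3 c v → c (v ⊖ 1) two ≢ c v two
3-config⇒2-edges-distinct c v three a≡d = 3≰2 (subst (_≤ 2) three≡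
  (length-deduplicate-yzy≤2 (c (v ⊖ 1) two) (c v one)))
  where
  three≡ : length (deduplicate _≟ℕ_ (c (v ⊖ 1) two ∷ c v one ∷ c (v ⊖ 1) two ∷ [])) ≡ 3
  three≡ = subst (λ w → length (deduplicate _≟ℕ_ (c (v ⊖ 1) two ∷ c v one ∷ w ∷ [])) ≡ 3)
    (sym a≡d) three
  3≰2 : ¬ (3 ≤ 2)
  3≰2 (s≤s (s≤s ()))

equal-2-edges⇒2-config : ∀ {N} (c : Colouring N) → Proper c → (v : Fin N) →
  c (v ⊖ 1) two ≡ c v two → IsKConfig 2 c v
equal-2-edges⇒2-config c proper v a≡d =
  subst (λ w → length (deduplicate _≟ℕ_ (w ∷ c v one ∷ c v two ∷ [])) ≡ 2) (sym a≡d)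
    (length-deduplicate-yzy (proper v p1 p3 (λ ())))

module ForcedColours {k : ℕ} (c : Colouring (suc (suc k)))
  (proper : Proper c) (saturated : Saturated c) (v : Fin (suc (suc k)))
  (2-edges-distinct : c (v ⊖ 1) two ≢ c v two) where

  ⊕1⊖1 : (v ⊕ 1) ⊖ 1 ≡ v
  ⊕1⊖1 = ⊕-⊖-cancel v (s≤s z≤n)

  ⊕1⊖2 : (v ⊕ 1) ⊖ 2 ≡ v ⊖ 1
  ⊕1⊖2 = trans (sym (⊖-⊖ (v ⊕ 1) {1} {1} (s≤s (s≤s z≤n)))) (cong (_⊖ 1) ⊕1⊖1)

  ⊕2⊖1 : (v ⊕ 2) ⊖ 1 ≡ v ⊕ 1
  ⊕2⊖1 = trans (cong (_⊖ 1) (sym (⊕-assoc v 1 1))) (⊕-⊖-cancel (v ⊕ 1) (s≤s z≤n))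

  ⊕2⊖2 : (v ⊕ 2) ⊖ 2 ≡ v
  ⊕2⊖2 = ⊕-⊖-cancel v (s≤s (s≤s z≤n))

  ⊖1⊖1 : (v ⊖ 1) ⊖ 1 ≡ v ⊖ 2
  ⊖1⊖1 = ⊖-⊖ v {1} {1} (s≤s (s≤s z≤n))

  1-edge≢left-2-edge : c v one ≢ c (v ⊖ 1) two
  1-edge≢left-2-edge = proper-at c proper (v ⊕ 1) p2 p4 (λ ()) ⊕1⊖1 ⊕1⊖2

  next-1-edge≢right-2-edge : c (v ⊕ 1) one ≢ c v two
  next-1-edge≢right-2-edge = proper-at c proper (v ⊕ 2) p2 p4 (λ ()) ⊕2⊖1 ⊕2⊖2

  left-colour-at-v : c (v ⊖ 2) two ≡ c (v ⊖ 1) two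
  left-colour-at-v = forced (saturated (v ⊖ 1) two v)
    where
    forced : ∃ (λ p → incColour c v p ≡ c (v ⊖ 1) two) → c (v ⊖ 2) two ≡ c (v ⊖ 1) two
    forced (p1 , eq) = ⊥-elim (1-edge≢left-2-edge eq)
    forced (p2 , eq) = ⊥-elim (proper (v ⊖ 1) p1 p3 (λ ()) eq)
    forced (p3 , eq) = ⊥-elim (2-edges-distinct (sym eq))
    forced (p4 , eq) = eq

  right-colour-at-v+1 : c (v ⊕ 1) two ≡ c v two
  right-colour-at-v+1 = forced (saturated v two (v ⊕ 1))
    where
    forced : ∃ (λ p → incColour c (v ⊕ 1) p ≡ c v two) → c (v ⊕ 1) two ≡ c v two
    forced (p1 , eq) = ⊥-elim (next-1-edge≢right-2-edge eq)
    forced (p2 , eq) = ⊥-elim (proper-at c proper v p1 p3 (λ ()) (sym ⊕1⊖1) refl eq)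
    forced (p3 , eq) = eq
    forced (p4 , eq) = ⊥-elim (2-edges-distinct (trans (cong (λ u → c u two) (sym ⊕1⊖2)) eq))

  next-colour-at-v : c (v ⊖ 1) one ≡ c (v ⊕ 1) one
  next-colour-at-v = forced (saturated (v ⊕ 1) one v)
    where
    forced : ∃ (λ p → incColour c v p ≡ c (v ⊕ 1) one) → c (v ⊖ 1) one ≡ c (v ⊕ 1) one
    forced (p1 , eq) = ⊥-elim (proper-at c proper (v ⊕ 1) p1 p2 (λ ()) refl ⊕1⊖1 (sym eq))
    forced (p2 , eq) = eq
    forced (p3 , eq) = ⊥-elim (next-1-edge≢right-2-edge (sym eq))
    forced (p4 , eq) = ⊥-elim (proper-at c proper (v ⊕ 1) p1 p4 (λ ()) refl ⊕1⊖2
      (sym (trans (sym left-colour-at-v) eq)))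

-- The argument is local: it only needs 2n ≥ 2.
mainTheorem14 : (n : ℕ) → 3 ≤ n → 2 ∣ n →
    (c : Colouring (2 * n)) → IsOneFactorisation c →
    (v : Fin (2 * n)) → IsKConfig 3 c v →
    IsKConfig 2 c (v ⊖ 1) × IsKConfig 2 c (v ⊕ 1)
      × c (v ⊖ 1) one ≡ c (v ⊕ 1) one
mainTheorem14 (suc (suc (suc m))) _ _ c (proper , saturated) v three =
    equal-2-edges⇒2-config c proper (v ⊖ 1) (trans (cong (λ u → c u two) ⊖1⊖1) left-colour-at-v)
  , equal-2-edges⇒2-config c proper (v ⊕ 1) (trans (cong (λ u → c u two) ⊕1⊖1) (sym right-colour-at-v+1))
  , next-colour-at-v
  where open ForcedColours c proper saturated v (3-config⇒2-edges-distinct c v three)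
mainTheorem14 (suc zero) (s≤s ()) _
mainTheorem14 (suc (suc zero)) (s≤s (s≤s ())) _
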